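{- Let $G$ be a finite simple graph on $n$ vertices $v_1,\dots,v_n$ with no isolated vertices, and suppose $G \neq K_{1,m}$ for every $m \geq 0$. Let $t \in \mathbb{N}$ and let $\widehat\alpha$ be an automorphism of the generalized Mycielskian $\mu^{(t)}(G)$. Then: (i) $\widehat\alpha$ preserves levels, i.e. $\widehat\alpha(\{u_1^s,\dots,u_n^s\}) \subseteq \{u_1^s,\dots,u_n^s\}$ for all $0 \le s \le t$; (ii) the restriction of $\widehat\alpha$ to $\{u_1^0,\dots,u_n^0\} = \{v_1,\dots,v_n\}$ is an automorphism $\alpha$ of $G$; (iii) if, in addition, $G$ is twin-free, then $\alpha(v_i) = v_j$ if and only if $\widehat\alpha(u_i^s) = u_j^s$ for all $0 < s \le t$.
   Context: All graphs are finite and simple. For $t \in \mathbb{N}$ (so $t \ge 1$) and a graph $G$ with $V(G)=\{v_1,\dots,v_n\}$, the generalized Mycielskian $\mu^{(t)}(G)$ has vertex set $\{u_i^s : 1\le i\le n,\ 0\le s\le t\} \cup \{w\}$, where $u_i^0$ is identified with $v_i$. For each edge $v_iv_j$ of $G$ it has the edges $u_i^0u_j^0$ and $u_i^su_j^{s+1}$, $u_j^su_i^{s+1}$ for $0 \le s < t$; in addition it has the edges $u_i^t w$ for $1 \le i \le n$, and no other edges. Vertex $u_i^s$ is said to be at level $s$; $w$ is the shadow master. Two vertices are twins if they have the same open neighborhood; a graph is twin-free if it has no pair of distinct twin vertices. $K_{1,m}$ denotes the star with $m$ leaves. -}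

module Defs where

open import Data.Nat using (ℕ; zero; suc)
open import Data.Fin using (Fin; toℕ)
import Data.Fin as F
open import Data.Empty using (⊥)
open import Data.Unit using (⊤)
open import Data.Product using (Σ; ∃; _×_; _,_; proj₁; proj₂)
open import Data.Sum using (_⊎_; inj₁; inj₂; swap)
open import Relation.Nullary using (¬_)
open import Relation.Binary.PropositionalEquality using (_≡_; _≢_; refl)
open import Function.Bundles using (_↔_; _⇔_; Inverse)

record Graph (V : Set) : Set₁ where
  field
    Adj    : V → V → Set
    sym    : ∀ {x y} → Adj x y → Adj y x
    irrefl : ∀ {x} → ¬ Adj x x
open Graph public

record Iso {V W : Set} (G : Graph V) (H : Graph W) : Set where
  field
    bij : V ↔ W
    adj : ∀ x y → Adj G x y ⇔ Adj H (Inverse.to bij x) (Inverse.to bij y)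
open Iso public

Aut : ∀ {V} → Graph V → Set
Aut G = Iso G G

apply : ∀ {V W} {G : Graph V} {H : Graph W} → Iso G H → V → W
apply φ = Inverse.to (bij φ)

NoIsolated : ∀ {V} → Graph V → Set
NoIsolated {V} G = ∀ (x : V) → ∃ λ y → Adj G x y

Twins : ∀ {V} → Graph V → V → V → Set
Twins G x y = ∀ z → Adj G x z ⇔ Adj G y z

TwinFree : ∀ {V} → Graph V → Set
TwinFree {V} G = ∀ (x y : V) → Twins G x y → x ≡ y

StarAdj : ∀ m → Fin (suc m) → Fin (suc m) → Set
StarAdj m x y = (x ≡ F.zero × y ≢ F.zero) ⊎ (y ≡ F.zero × x ≢ F.zero)

star : (m : ℕ) → Graph (Fin (suc m))
star m = record
  { Adj = StarAdj m
  ; sym = swap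
  ; irrefl = λ { (inj₁ (p , q)) → q p ; (inj₂ (p , q)) → q p } }

-- Vertices of the generalized Mycielskian μ^(t)(G) for G on Fin n:
-- u i s  is  u_i^s  (level s ∈ {0..t}), and  w  is the shadow master.
data MVertex (n t : ℕ) : Set where
  u : Fin n → Fin (suc t) → MVertex n t
  w : MVertex n t

MAdj : ∀ {n} t → Graph (Fin n) → MVertex n t → MVertex n t → Set
MAdj t G (u i s) (u j r) =
    (toℕ s ≡ 0 × toℕ r ≡ 0 × Adj G i j)
  ⊎ (toℕ r ≡ suc (toℕ s) × Adj G i j)
  ⊎ (toℕ s ≡ suc (toℕ r) × Adj G i j)
MAdj t G (u i s) w = toℕ s ≡ t
MAdj t G w (u j r) = toℕ r ≡ t
MAdj t G w w = ⊥

private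
  msym : ∀ {n} t (G : Graph (Fin n)) {x y} → MAdj t G x y → MAdj t G y x
  msym t G {u i s} {u j r} (inj₁ (a , b , e)) = inj₁ (b , a , sym G e)
  msym t G {u i s} {u j r} (inj₂ (inj₁ (a , e))) = inj₂ (inj₂ (a , sym G e))
  msym t G {u i s} {u j r} (inj₂ (inj₂ (a , e))) = inj₂ (inj₁ (a , sym G e))
  msym t G {u i s} {w} p = p
  msym t G {w} {u j r} p = p
  msym t G {w} {w} ()

  suc≢ : ∀ k → k ≢ suc k
  suc≢ zero ()
  suc≢ (suc k) ()

  mirr : ∀ {n} t (G : Graph (Fin n)) {x} → ¬ MAdj t G x x
  mirr t G {u i s} (inj₁ (_ , _ , e)) = irrefl G e
  mirr t G {u i s} (inj₂ (inj₁ (a , _))) = suc≢ _ a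
  mirr t G {u i s} (inj₂ (inj₂ (a , _))) = suc≢ _ a
  mirr t G {w} ()

mycielskian : ∀ {n} (t : ℕ) → Graph (Fin n) → Graph (MVertex n t)
mycielskian t G = record { Adj = MAdj t G ; sym = msym t G ; irrefl = mirr t G }

-- Call v covered if every neighbour a of v has a non-neighbour b of v with N(a) ∖ {v} ⊆ N(b);
-- automorphisms preserve this. The shadow master w is covered (for a = u_i^t take b = u_i^(t-2)),
-- while if some u_k^s is covered then every neighbour of k is a leaf. Every vertex lies within
-- distance t + 1 of w, and walks of that length starting at level 0 avoid w, hence project to
-- walks in G; so an automorphism sending w to u_k^s would make G a star centred at k. Once w is
-- fixed, the distance t + 1 - s from level s to w is preserved, hence so are the levels, and
-- level 0 carries an automorphism α of G. For twin-free G, induction on s gives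
-- α̂(u_i^s) = u_(α i)^s: the neighbours of u_i^(s+1) on level s are the u_y^s with y adjacent to
-- i, so if α̂(u_i^(s+1)) = u_k^(s+1) then k and α(i) are twins in G.

module Submission where

open import Defs hiding (sym)
open import Data.Nat using (ℕ; zero; suc; _+_; _∸_; _≤_; _<_; z≤n; s≤s)
open import Data.Nat.Properties
  using ( ≤-refl; ≤-reflexive; ≤-trans; ≤-antisym; ≤-<-trans; <⇒≤; <⇒≢; 1+n≰n; n<1+n
        ; m≤m+n; m≤n+m; +-suc; +-monoˡ-≤; +-monoʳ-≤; +-cancelˡ-≤
        ; m∸n≤m; m∸n+n≡m; ∸-monoʳ-<; module ≤-Reasoning )
open import Data.Fin using (Fin; toℕ; zero; suc; fromℕ<; inject₁)
open import Data.Fin.Properties using (toℕ≤pred[n]; toℕ-injective; toℕ-fromℕ<; toℕ-inject₁; _≟_)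
open import Data.Fin.Induction using (<-weakInduction)
import Data.Fin.Permutation as Permutation
import Data.Fin.Permutation.Components as PermutationComponents
open import Data.Product using (Σ; ∃; _×_; _,_; proj₁; proj₂)
open import Data.Sum using (_⊎_; inj₁; inj₂)
open import Data.Empty using (⊥-elim)
open import Relation.Nullary using (¬_; yes; no)
open import Relation.Nullary.Decidable using (dec-true)
open import Relation.Binary.PropositionalEquality
  using (_≡_; _≢_; refl; sym; trans; cong; subst; subst₂; module ≡-Reasoning)
open import Function.Base using (_∘_)
open import Function.Bundles using (_⇔_; Inverse; Equivalence; mk⇔; mk↔ₛ′)
open import Function.Construct.Symmetry using (↔-sym; ⇔-sym)
open import Function.Construct.Composition using (_⇔-∘_)

module _ {V W : Set} {G : Graph V} {H : Graph W} (φ : Iso G H) where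

  unapply : W → V
  unapply = Inverse.from (bij φ)

  apply-unapply : ∀ y → apply φ (unapply y) ≡ y
  apply-unapply = Inverse.strictlyInverseˡ (bij φ)

  unapply-apply : ∀ x → unapply (apply φ x) ≡ x
  unapply-apply = Inverse.strictlyInverseʳ (bij φ)

  apply-injective : ∀ {x y} → apply φ x ≡ apply φ y → x ≡ y
  apply-injective {x} {y} e = trans (sym (unapply-apply x)) (trans (cong unapply e) (unapply-apply y))

  apply-adj : ∀ {x y} → Adj G x y → Adj H (apply φ x) (apply φ y)
  apply-adj {x} {y} = Equivalence.to (adj φ x y)

  unapply-adj : ∀ {x y} → Adj H (apply φ x) (apply φ y) → Adj G x y
  unapply-adj {x} {y} = Equivalence.from (adj φ x y)

  adj-image : ∀ {x y x′ y′} → apply φ x ≡ x′ → apply φ y ≡ y′ → Adj G x y ⇔ Adj H x′ y′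
  adj-image {x} {y} refl refl = adj φ x y

  Iso-sym : Iso H G
  Iso-sym = record
    { bij = ↔-sym (bij φ)
    ; adj = λ x y → ⇔-sym (adj-image (apply-unapply x) (apply-unapply y))
    }

twins-of-image : ∀ {V} {G : Graph V} (α : Aut G) {i k} →
                 (∀ y → Adj G i y ⇔ Adj G k (apply α y)) → Twins G k (apply α i)
twins-of-image {G = G} α {i} {k} same z =
  subst (λ z′ → Adj G k z′ ⇔ Adj G (apply α i) z′) (apply-unapply α z)
        (adj α i (unapply α z) ⇔-∘ ⇔-sym (same (unapply α z)))

data Walk {V : Set} (G : Graph V) : ℕ → V → V → Set where
  []  : ∀ {x} → Walk G 0 x x
  _∷_ : ∀ {L x y z} → Adj G x y → Walk G L y z → Walk G (suc L) x z

Connected : ∀ {V} → Graph V → V → V → Set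
Connected G x y = ∃ λ L → Walk G L x y

map-walk : ∀ {V W} {G : Graph V} {H : Graph W} (φ : Iso G H) {L x y} →
           Walk G L x y → Walk H L (apply φ x) (apply φ y)
map-walk φ []      = []
map-walk φ (e ∷ p) = apply-adj φ e ∷ map-walk φ p

module _ {V : Set} {G : Graph V} (f : V → ℕ) (f-step : ∀ {x y} → Adj G x y → f y ≤ suc (f x)) where

  walk-bounds-growth : ∀ {L x y} → Walk G L x y → f y ≤ L + f x
  walk-bounds-growth []      = ≤-refl
  walk-bounds-growth {suc L} {x} {z} (_∷_ {y = y} e p) = begin
    f z           ≤⟨ walk-bounds-growth p ⟩
    L + f y       ≤⟨ +-monoʳ-≤ L (f-step e) ⟩
    L + suc (f x) ≡⟨ +-suc L (f x) ⟩
    suc L + f x   ∎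
    where open ≤-Reasoning

Centred : ∀ {V : Set} → V → V → V → Set
Centred k x y = (x ≡ k × y ≢ k) ⊎ (y ≡ k × x ≢ k)

IsStarCentre : ∀ {V} → Graph V → V → Set
IsStarCentre G k = ∀ x y → Adj G x y ⇔ Centred k x y

module _ {V W : Set} (f : V → W) {k : V} {c : W} (f≡c⇔ : ∀ x → f x ≡ c ⇔ x ≡ k) where

  Centred-image : ∀ {x y} → Centred k x y ⇔ Centred c (f x) (f y)
  Centred-image {x} {y} = mk⇔ forth back
    where
      to : ∀ z → f z ≡ c → z ≡ k
      to z = Equivalence.to (f≡c⇔ z)
      from : ∀ z → z ≡ k → f z ≡ c
      from z = Equivalence.from (f≡c⇔ z)
      forth : Centred k x y → Centred c (f x) (f y)
      forth (inj₁ (x≡k , y≢k)) = inj₁ (from x x≡k , λ fy≡c → y≢k (to y fy≡c))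
      forth (inj₂ (y≡k , x≢k)) = inj₂ (from y y≡k , λ fx≡c → x≢k (to x fx≡c))
      back : Centred c (f x) (f y) → Centred k x y
      back (inj₁ (fx≡c , fy≢c)) = inj₁ (to x fx≡c , λ y≡k → fy≢c (from y y≡k))
      back (inj₂ (fy≡c , fx≢c)) = inj₂ (to y fy≡c , λ x≡k → fx≢c (from x x≡k))

transpose-self : ∀ {n} (i j : Fin n) → PermutationComponents.transpose i j i ≡ j
transpose-self i j rewrite dec-true (i ≟ i) refl = refl

iso-star : ∀ {m} {G : Graph (Fin (suc m))} {k} → IsStarCentre G k → Iso G (star m)
iso-star {m} {G} {k} centre = record
  { bij = π
  ; adj = λ x y → Centred-image (Inverse.to π) π≡0⇔ ⇔-∘ centre x y
  }
  where
    π : Permutation.Permutation′ (suc m)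
    π = Permutation.transpose k zero
    π≡0⇔ : ∀ x → Inverse.to π x ≡ zero ⇔ x ≡ k
    π≡0⇔ x = mk⇔
      (λ πx≡0 → trans (sym (Inverse.strictlyInverseʳ π x))
                      (trans (cong (Inverse.from π) πx≡0) (transpose-self zero k)))
      (λ { refl → transpose-self k zero })

LeafNeighbours : ∀ {V} → Graph V → V → Set
LeafNeighbours G k = ∀ {j l} → Adj G k j → Adj G j l → l ≡ k

module _ {V : Set} {G : Graph V} {k : V} (leaves : LeafNeighbours G k) where

  walk-to-leaf-centre : ∀ {L a} → Walk G L a k → a ≡ k ⊎ Adj G k a
  walk-to-leaf-centre [] = inj₁ refl
  walk-to-leaf-centre (ab ∷ p) with walk-to-leaf-centre p
  ... | inj₁ refl = inj₂ (Graph.sym G ab)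
  ... | inj₂ kb   = inj₁ (leaves kb (Graph.sym G ab))

  leaf-neighbours⇒star-centre : (∀ y → Connected G y k) → IsStarCentre G k
  leaf-neighbours⇒star-centre connected x y = mk⇔ forth back
    where
      near : ∀ z → z ≡ k ⊎ Adj G k z
      near z = walk-to-leaf-centre (proj₂ (connected z))
      ¬loop : ∀ {z} → Adj G k z → z ≢ k
      ¬loop kz refl = Graph.irrefl G kz
      forth : Adj G x y → Centred k x y
      forth xy with near x
      ... | inj₁ refl = inj₁ (refl , ¬loop xy)
      ... | inj₂ kx   = inj₂ (leaves kx xy , ¬loop kx)
      half : ∀ {a b} → a ≡ k → b ≢ k → Adj G a b
      half {b = b} refl b≢k with near b
      ... | inj₁ b≡k = ⊥-elim (b≢k b≡k)
      ... | inj₂ kb  = kb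
      back : Centred k x y → Adj G x y
      back (inj₁ (x≡k , y≢k)) = half x≡k y≢k
      back (inj₂ (y≡k , x≢k)) = Graph.sym G (half y≡k x≢k)

NeighboursCovered : ∀ {V} → Graph V → V → Set
NeighboursCovered G v =
  ∀ {a} → Adj G v a → ∃ λ b → ¬ Adj G v b × (∀ {z} → Adj G a z → z ≢ v → Adj G b z)

NeighboursCovered-image : ∀ {V W} {G : Graph V} {H : Graph W} (φ : Iso G H) {v} →
                          NeighboursCovered G v → NeighboursCovered H (apply φ v)
NeighboursCovered-image {H = H} φ {v} covered {a} φv-a
  with covered (unapply-adj φ (subst (Adj H (apply φ v)) (sym (apply-unapply φ a)) φv-a))
... | b , ¬vb , covers = apply φ b , (λ φv-φb → ¬vb (unapply-adj φ φv-φb)) , covers′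
  where
    covers′ : ∀ {z} → Adj H a z → z ≢ apply φ v → Adj H (apply φ b) z
    covers′ {z} az z≢φv =
      subst (Adj H (apply φ b)) (apply-unapply φ z)
        (apply-adj φ (covers (apply-adj (Iso-sym φ) az)
                             (λ z′≡v → z≢φv (trans (sym (apply-unapply φ z)) (cong (apply φ) z′≡v)))))

uncovered : ∀ {V} {G : Graph V} {v a z₁ z₂} →
            Adj G v a → Adj G a z₁ → z₁ ≢ v → Adj G a z₂ → z₂ ≢ v →
            (∀ {b} → Adj G b z₁ → Adj G b z₂ → Adj G v b) → ¬ NeighboursCovered G v
uncovered va az₁ z₁≢v az₂ z₂≢v common covered with covered va
... | _ , ¬vb , covers = ¬vb (common (covers az₁ z₁≢v) (covers az₂ z₂≢v))

¬IsStarCentre : ∀ {n} {G : Graph (Fin n)} → (∀ m → ¬ Iso G (star m)) → ∀ {k} → ¬ IsStarCentre G k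
¬IsStarCentre {suc m} not-star centre = not-star m (iso-star centre)

data LevelStep : ℕ → ℕ → Set where
  stay : LevelStep 0 0
  up   : ∀ {ℓ} → LevelStep ℓ (suc ℓ)
  down : ∀ {ℓ} → LevelStep (suc ℓ) ℓ

LevelStep⇔ : ∀ {a b} {X : Set} →
             ((a ≡ 0 × b ≡ 0 × X) ⊎ (b ≡ suc a × X) ⊎ (a ≡ suc b × X)) ⇔ (LevelStep a b × X)
LevelStep⇔ = mk⇔ forth back
  where
    forth : ∀ {a b X} → (a ≡ 0 × b ≡ 0 × X) ⊎ (b ≡ suc a × X) ⊎ (a ≡ suc b × X) → LevelStep a b × X
    forth (inj₁ (refl , refl , x))   = stay , x
    forth (inj₂ (inj₁ (refl , x)))   = up , x
    forth (inj₂ (inj₂ (refl , x)))   = down , x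
    back : ∀ {a b X} → LevelStep a b × X → (a ≡ 0 × b ≡ 0 × X) ⊎ (b ≡ suc a × X) ⊎ (a ≡ suc b × X)
    back (stay , x) = inj₁ (refl , refl , x)
    back (up , x)   = inj₂ (inj₁ (refl , x))
    back (down , x) = inj₂ (inj₂ (refl , x))

LevelStep-sym : ∀ {a b} → LevelStep a b → LevelStep b a
LevelStep-sym stay = stay
LevelStep-sym up   = down
LevelStep-sym down = up

LevelStep-≤ : ∀ {a b} → LevelStep a b → b ≤ suc a
LevelStep-≤ stay = z≤n
LevelStep-≤ up   = ≤-refl
LevelStep-≤ down = m≤n+m _ 2

LevelStep-pred : ∀ a → LevelStep a (a ∸ 1)
LevelStep-pred zero    = stay
LevelStep-pred (suc a) = down

LevelStep-≤⇒pred : ∀ {a b} → LevelStep a b → b ≤ a → b ≡ a ∸ 1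
LevelStep-≤⇒pred stay _ = refl
LevelStep-≤⇒pred up   b≤a = ⊥-elim (1+n≰n b≤a)
LevelStep-≤⇒pred down _ = refl

∸1≢ : ∀ {ℓ x} → ℓ < x → ℓ ∸ 1 ≢ x
∸1≢ {ℓ} ℓ<x = <⇒≢ (≤-<-trans (m∸n≤m ℓ 1) ℓ<x)

LevelStep-common₀ : ∀ {c a b} → LevelStep c a → LevelStep c b → a ≡ 0 → b ≡ 1 → c ≡ 0
LevelStep-common₀ stay _    refl refl = refl
LevelStep-common₀ down ()   refl refl

LevelStep-common : ∀ {c a b ℓ} → LevelStep c a → LevelStep c b → a ≡ suc ℓ → b ≡ ℓ ∸ 1 → c ≡ ℓ
LevelStep-common up   _    refl _ = refl
LevelStep-common down up   refl b≡ = ⊥-elim (∸1≢ (m≤n+m _ 2) (sym b≡))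
LevelStep-common down down refl b≡ = ⊥-elim (∸1≢ ≤-refl (sym b≡))

module Mycielskian {n : ℕ} (G : Graph (Fin n)) (t : ℕ) where

  M : Graph (MVertex n t)
  M = mycielskian t G

  u-injective : ∀ {i j s r} → u {n} {t} i s ≡ u j r → i ≡ j × s ≡ r
  u-injective refl = refl , refl

  u-adj⇔ : ∀ {i j s r} → Adj M (u i s) (u j r) ⇔ (LevelStep (toℕ s) (toℕ r) × Adj G i j)
  u-adj⇔ = LevelStep⇔

  edge-levels : ∀ {i j s r} → Adj M (u i s) (u j r) → LevelStep (toℕ s) (toℕ r)
  edge-levels e = proj₁ (Equivalence.to u-adj⇔ e)

  project-edge : ∀ {i j s r} → Adj M (u i s) (u j r) → Adj G i j
  project-edge e = proj₂ (Equivalence.to u-adj⇔ e)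

  edge-at : ∀ {i j s r a b} → toℕ s ≡ a → toℕ r ≡ b → LevelStep a b → Adj G i j → Adj M (u i s) (u j r)
  edge-at s≡a r≡b step ij = Equivalence.from u-adj⇔ (subst₂ LevelStep (sym s≡a) (sym r≡b) step , ij)

  level₀⇔ : ∀ {i j} → Adj G i j ⇔ Adj M (u i zero) (u j zero)
  level₀⇔ = mk⇔ (edge-at refl refl stay) project-edge

  descend⇔ : ∀ {i j s r} → toℕ s ≡ suc (toℕ r) → Adj G i j ⇔ Adj M (u i s) (u j r)
  descend⇔ s≡ = mk⇔ (edge-at s≡ refl down) project-edge

  index : ∀ {ℓ} → ℓ ≤ t → Fin (suc t)
  index ℓ≤t = fromℕ< (s≤s ℓ≤t)

  toℕ-index : ∀ {ℓ} (ℓ≤t : ℓ ≤ t) → toℕ (index ℓ≤t) ≡ ℓ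
  toℕ-index ℓ≤t = toℕ-fromℕ< (s≤s ℓ≤t)

  level : MVertex n t → ℕ
  level (u _ s) = toℕ s
  level w       = suc t

  level-adj-≤ : ∀ {x y} → Adj M x y → level y ≤ suc (level x)
  level-adj-≤ {u _ _} {u _ _} e   = LevelStep-≤ (edge-levels e)
  level-adj-≤ {u _ _} {w}     s≡t = ≤-reflexive (cong suc (sym s≡t))
  level-adj-≤ {w}     {u _ r} _   = ≤-trans (toℕ≤pred[n] r) (m≤n+m t 2)

  project-walk : ∀ {L i r k s} → Walk M L (u i r) (u k s) → Connected G i k ⊎ suc (suc t) ≤ toℕ r + L
  project-walk [] = inj₁ (0 , [])
  project-walk {suc L} {r = r} (_∷_ {y = u j r′} e p) with project-walk p
  ... | inj₁ (L′ , q) = inj₁ (suc L′ , project-edge e ∷ q)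
  ... | inj₂ long     = inj₂ (begin
    suc (suc t)    ≤⟨ long ⟩
    toℕ r′ + L     ≤⟨ +-monoˡ-≤ L (level-adj-≤ e) ⟩
    suc (toℕ r) + L ≡⟨ sym (+-suc (toℕ r) L) ⟩
    toℕ r + suc L  ∎)
    where open ≤-Reasoning
  project-walk {suc (suc L)} {r = r} (_∷_ {y = w} r≡t (_ ∷ _)) = inj₂ (begin
    suc (suc t)         ≤⟨ s≤s (s≤s (m≤m+n t L)) ⟩
    suc (suc (t + L))   ≡⟨ cong suc (sym (+-suc t L)) ⟩
    suc (t + suc L)     ≡⟨ sym (+-suc t (suc L)) ⟩
    t + suc (suc L)     ≡⟨ cong (_+ suc (suc L)) (sym r≡t) ⟩
    toℕ r + suc (suc L) ∎)
    where open ≤-Reasoning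

  t∸s+s≡t : ∀ (s : Fin (suc t)) → t ∸ toℕ s + toℕ s ≡ t
  t∸s+s≡t s = m∸n+n≡m (toℕ≤pred[n] s)

  module _ (no-isolated : NoIsolated G) where

    climb : ∀ d {i s} → d + toℕ s ≡ t → Walk M (suc d) (u i s) w
    climb zero    s≡t = s≡t ∷ []
    climb (suc d) {i} {s} d+s≡t =
      edge-at refl (toℕ-index 1+s≤t) up (proj₂ (no-isolated i)) ∷ climb d d+s′≡t
      where
        1+s≤t : suc (toℕ s) ≤ t
        1+s≤t = subst (suc (toℕ s) ≤_) (trans (+-suc d (toℕ s)) d+s≡t) (m≤n+m (suc (toℕ s)) d)
        d+s′≡t : d + toℕ (index 1+s≤t) ≡ t
        d+s′≡t = trans (cong (d +_) (toℕ-index 1+s≤t)) (trans (+-suc d (toℕ s)) d+s≡t)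

    reach-w : ∀ x → ∃ λ L → L ≤ suc t × Walk M L x w
    reach-w (u i s) = suc (t ∸ toℕ s) , s≤s (m∸n≤m t (toℕ s)) , climb (t ∸ toℕ s) (t∸s+s≡t s)
    reach-w w       = 0 , z≤n , []

  module _ (t≥1 : 1 ≤ t) where

    w-covered : NeighboursCovered M w
    w-covered {u i r} r≡t = u i b , ¬w-b , covers
      where
        t∸2≤t : t ∸ 1 ∸ 1 ≤ t
        t∸2≤t = ≤-trans (m∸n≤m (t ∸ 1) 1) (m∸n≤m t 1)
        b : Fin (suc t)
        b = index t∸2≤t   -- level t - 2, truncated to 0 when t = 1
        b≡ : toℕ b ≡ t ∸ 1 ∸ 1
        b≡ = toℕ-index t∸2≤t
        ¬w-b : ¬ Adj M w (u i b)
        ¬w-b b≡t = ∸1≢ (∸-monoʳ-< (s≤s z≤n) t≥1) (trans (sym b≡) b≡t)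
        covers : ∀ {z} → Adj M (u i r) z → z ≢ w → Adj M (u i b) z
        covers {w}      _ z≢w = ⊥-elim (z≢w refl)
        covers {u j r′} e _   = edge-at b≡ r′≡ (LevelStep-sym (LevelStep-pred (t ∸ 1))) (project-edge e)
          where
            r′≡ : toℕ r′ ≡ t ∸ 1
            r′≡ = trans (LevelStep-≤⇒pred (edge-levels e) (subst (toℕ r′ ≤_) (sym r≡t) (toℕ≤pred[n] r′)))
                        (cong (_∸ 1) r≡t)

    module _ {k j m : Fin n} (kj : Adj G k j) (jm : Adj G j m) (m≢k : m ≢ k) where

      uncovered-level₀ : ∀ {s} → toℕ s ≡ 0 → ¬ NeighboursCovered M (u k s)
      -- a = u_j^0, z₁ = u_m^0, z₂ = u_k^1: a common neighbour of z₁ and z₂ is some u_p^0, p ~ k.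
      uncovered-level₀ {s} s≡0 =
        uncovered {G = M} (edge-at s≡0 s≡0 stay kj) (edge-at s≡0 s≡0 stay jm) (m≢k ∘ proj₁ ∘ u-injective)
                  (edge-at s≡0 one≡1 up (Graph.sym G kj)) one≢s common
        where
          one : Fin (suc t)
          one = index t≥1
          one≡1 : toℕ one ≡ 1
          one≡1 = toℕ-index t≥1
          one≢s : u k one ≢ u k s
          one≢s e = 1≢0 (trans (sym one≡1) (trans (cong toℕ (proj₂ (u-injective e))) s≡0))
            where 1≢0 : 1 ≢ 0
                  1≢0 ()
          common : ∀ {b} → Adj M b (u m s) → Adj M b (u k one) → Adj M (u k s) b
          common {w}     s≡t _ = ⊥-elim (1+n≰n (subst (1 ≤_) (trans (sym s≡t) s≡0) t≥1))
          common {u p r} e₁ e₂ =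
            edge-at s≡0 (LevelStep-common₀ (edge-levels e₁) (edge-levels e₂) s≡0 one≡1) stay
                    (Graph.sym G (project-edge e₂))

      uncovered-level₊ : ∀ {s ℓ} → toℕ s ≡ suc ℓ → ¬ NeighboursCovered M (u k s)
      -- a = u_j^ℓ, z₁ = u_m^(ℓ+1), z₂ = u_k^(ℓ ∸ 1): a common neighbour is some u_p^ℓ, p ~ k.
      uncovered-level₊ {s} {ℓ} s≡ =
        uncovered {G = M} (edge-at s≡ s₁≡ down kj) (edge-at s₁≡ s≡ up jm) (m≢k ∘ proj₁ ∘ u-injective)
                  (edge-at s₁≡ s₂≡ (LevelStep-pred ℓ) (Graph.sym G kj)) s₂≢s common
        where
          ℓ<t : ℓ < t
          ℓ<t = subst (_≤ t) s≡ (toℕ≤pred[n] s)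
          ℓ∸1≤t : ℓ ∸ 1 ≤ t
          ℓ∸1≤t = ≤-trans (m∸n≤m ℓ 1) (<⇒≤ ℓ<t)
          s₁ s₂ : Fin (suc t)
          s₁ = index (<⇒≤ ℓ<t)
          s₂ = index ℓ∸1≤t
          s₁≡ : toℕ s₁ ≡ ℓ
          s₁≡ = toℕ-index (<⇒≤ ℓ<t)
          s₂≡ : toℕ s₂ ≡ ℓ ∸ 1
          s₂≡ = toℕ-index ℓ∸1≤t
          s₂≢s : u k s₂ ≢ u k s
          s₂≢s e = ∸1≢ (n<1+n ℓ) (trans (sym s₂≡) (trans (cong toℕ (proj₂ (u-injective e))) s≡))
          common : ∀ {b} → Adj M b (u m s) → Adj M b (u k s₂) → Adj M (u k s) b
          common {w}     _  s₂≡t = ⊥-elim (∸1≢ ℓ<t (trans (sym s₂≡) s₂≡t))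
          common {u p r} e₁ e₂ =
            edge-at s≡ (LevelStep-common (edge-levels e₁) (edge-levels e₂) s≡ s₂≡) down
                    (Graph.sym G (project-edge e₂))

    covered⇒leaf-neighbours : ∀ {k s} → NeighboursCovered M (u k s) → LeafNeighbours G k
    covered⇒leaf-neighbours {k} {s} covered {j} {m} kj jm with m ≟ k | toℕ s in s≡
    ... | yes m≡k | _     = m≡k
    ... | no m≢k  | zero  = ⊥-elim (uncovered-level₀ kj jm m≢k s≡ covered)
    ... | no m≢k  | suc _ = ⊥-elim (uncovered-level₊ kj jm m≢k s≡ covered)

  module Automorphisms
    (no-isolated : NoIsolated G) (not-star : ∀ m → ¬ Iso G (star m)) (t≥1 : 1 ≤ t) where

    w-fixed : (α̂ : Aut M) → apply α̂ w ≡ w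
    w-fixed α̂ with apply α̂ w in α̂w≡
    ... | w     = refl
    ... | u k s = ⊥-elim (¬IsStarCentre not-star (leaf-neighbours⇒star-centre leaves connected))
      where
        leaves : LeafNeighbours G k
        leaves = covered⇒leaf-neighbours t≥1
                   (subst (NeighboursCovered M) α̂w≡ (NeighboursCovered-image α̂ (w-covered t≥1)))
        connected : ∀ y → Connected G y k
        connected y with reach-w no-isolated (unapply α̂ (u y zero))
        ... | L , L≤1+t , p
          with project-walk (subst₂ (Walk M L) (apply-unapply α̂ (u y zero)) α̂w≡ (map-walk α̂ p))
        ...   | inj₁ y~k = y~k
        ...   | inj₂ long = ⊥-elim (1+n≰n (≤-trans long L≤1+t))

    level-monotone : (α̂ : Aut M) → ∀ {i j s r} → apply α̂ (u i s) ≡ u j r → toℕ s ≤ toℕ r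
    level-monotone α̂ {i} {j} {s} {r} α̂u≡ = +-cancelˡ-≤ (suc d) (toℕ s) (toℕ r) (begin
      suc d + toℕ s ≡⟨ cong suc (t∸s+s≡t s) ⟩
      suc t         ≤⟨ walk-bounds-growth level level-adj-≤ image ⟩
      suc d + toℕ r ∎)
      where
        open ≤-Reasoning
        d : ℕ
        d = t ∸ toℕ s
        image : Walk M (suc d) (u j r) w
        image = subst₂ (Walk M (suc d)) α̂u≡ (w-fixed α̂) (map-walk α̂ (climb no-isolated d (t∸s+s≡t s)))

    level-preserving : (α̂ : Aut M) → ∀ i s → ∃ λ j → apply α̂ (u i s) ≡ u j s
    level-preserving α̂ i s with apply α̂ (u i s) in α̂u≡
    ... | w     = ⊥-elim (u≢w (apply-injective α̂ (trans α̂u≡ (sym (w-fixed α̂)))))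
      where
        u≢w : u i s ≢ w
        u≢w ()
    ... | u j r =
      j , cong (u j) (toℕ-injective (≤-antisym (level-monotone (Iso-sym α̂) back) (level-monotone α̂ α̂u≡)))
      where
        back : unapply α̂ (u j r) ≡ u i s
        back = trans (cong (unapply α̂) (sym α̂u≡)) (unapply-apply α̂ (u i s))

    module _ (α̂ : Aut M) where

      base : Fin n → Fin n
      base i = proj₁ (level-preserving α̂ i zero)

      base-spec : ∀ i → apply α̂ (u i zero) ≡ u (base i) zero
      base-spec i = proj₂ (level-preserving α̂ i zero)

    base-inverse : (α̂ β̂ : Aut M) → (∀ x → apply α̂ (apply β̂ x) ≡ x) → ∀ i → base α̂ (base β̂ i) ≡ i
    base-inverse α̂ β̂ α̂β̂≡ i = proj₁ (u-injective (begin
      u (base α̂ (base β̂ i)) zero ≡⟨ sym (base-spec α̂ (base β̂ i)) ⟩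
      apply α̂ (u (base β̂ i) zero) ≡⟨ cong (apply α̂) (sym (base-spec β̂ i)) ⟩
      apply α̂ (apply β̂ (u i zero)) ≡⟨ α̂β̂≡ (u i zero) ⟩
      u i zero ∎))
      where open ≡-Reasoning

    restrict : Aut M → Aut G
    restrict α̂ = record
      { bij = mk↔ₛ′ (base α̂) (base (Iso-sym α̂)) (base-inverse α̂ (Iso-sym α̂) (apply-unapply α̂))
                                                 (base-inverse (Iso-sym α̂) α̂ (unapply-apply α̂))
      ; adj = λ i j → ⇔-sym level₀⇔ ⇔-∘ (adj-image α̂ (base-spec α̂ i) (base-spec α̂ j) ⇔-∘ level₀⇔)
      }

    module _ (twin-free : TwinFree G) (α̂ : Aut M) where

      α : Aut G
      α = restrict α̂

      α̂-on-levels : ∀ s i → apply α̂ (u i s) ≡ u (apply α i) s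
      α̂-on-levels = <-weakInduction (λ s → ∀ i → apply α̂ (u i s) ≡ u (apply α i) s) (base-spec α̂) step
        where
          step : ∀ s → (∀ i → apply α̂ (u i (inject₁ s)) ≡ u (apply α i) (inject₁ s)) →
                 ∀ i → apply α̂ (u i (suc s)) ≡ u (apply α i) (suc s)
          step s below i with level-preserving α̂ i (suc s)
          ... | k , α̂u≡ =
            trans α̂u≡ (cong (λ k′ → u k′ (suc s)) (twin-free k (apply α i) (twins-of-image α same)))
            where
              s≡ : toℕ {suc t} (suc s) ≡ suc (toℕ (inject₁ s))
              s≡ = cong suc (sym (toℕ-inject₁ s))
              same : ∀ y → Adj G i y ⇔ Adj G k (apply α y)
              same y = ⇔-sym (descend⇔ s≡) ⇔-∘ (adj-image α̂ α̂u≡ (below y) ⇔-∘ descend⇔ s≡)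

      image⇔ : ∀ i j → apply α i ≡ j ⇔ (∀ (s : Fin (suc t)) → 0 < toℕ s → apply α̂ (u i s) ≡ u j s)
      image⇔ i j = mk⇔ (λ { refl s _ → α̂-on-levels s i }) (λ on-levels → proj₁ (u-injective
        (trans (sym (α̂-on-levels (index t≥1) i)) (on-levels (index t≥1) 0<one))))
        where
          0<one : 0 < toℕ (index t≥1)
          0<one = subst (0 <_) (sym (toℕ-index t≥1)) (s≤s z≤n)

lemma3 : (n : ℕ) (G : Graph (Fin n)) → NoIsolated G
    → (∀ (m : ℕ) → ¬ Iso G (star m))
    → (t : ℕ) → 1 ≤ t
    → (α̂ : Aut (mycielskian t G))
    → (∀ (i : Fin n) (s : Fin (suc t)) → ∃ λ j → apply α̂ (u i s) ≡ u j s)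
      × (Σ (Aut G) λ α →
          (∀ (i : Fin n) → apply α̂ (u i zero) ≡ u (apply α i) zero)
          × (TwinFree G → ∀ (i j : Fin n) →
               (apply α i ≡ j ⇔ (∀ (s : Fin (suc t)) → 0 < toℕ s → apply α̂ (u i s) ≡ u j s))))
lemma3 n G no-isolated not-star t t≥1 α̂ =
  level-preserving α̂ , restrict α̂ , base-spec α̂ , λ twin-free → image⇔ twin-free α̂
  where
    open Mycielskian G t
    open Automorphisms no-isolated not-star t≥1
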